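{- The fractional cost of the adjusted correlation metric $f$ in the $\ell_1$-norm objective is within a constant factor of $\mathsf{OPT}(1)$: there is an absolute constant $c$ such that $$\sum_{u\in V}\sum_{v\in N_u^+}f_{uv}+\sum_{u\in V}\sum_{v\in N_u^- }(1-f_{uv})\le c\cdot\mathsf{OPT}(1).$$
   Context: $G=(V,E)$ is a complete graph with every edge labeled positive or negative; every vertex has a positive self-loop. $N_u^+$ ($N_u^-$) is the set of $v$ with $(u,v)$ positive (negative), and $\Delta_u=|N_u^+|$. The correlation metric is $d_{uv}=1-\frac{|N_u^+\cap N_v^+|}{|N_u^+\cup N_v^+|}$. The adjusted correlation metric $f$: (1) set $f=d$; (2) for every negative edge $(u,v)$ with $d_{uv}>0.7$ set $f_{uv}=1$; (3) for every $u$ with $|N_u^-\cap\{v: d_{uv}\le 0.7\}|\ge\frac{10}{3}\Delta_u$, set $f_{uv}=1$ for all $v\ne u$. A clustering is a partition of $V$; a positive edge is a disagreement if its endpoints are in different clusters, a negative edge if in the same cluster; $y_{\mathcal{C}}(u)$ counts disagreements at $u$; $\mathsf{OPT}(1)=\min_{\mathcal{C}}\sum_u y_{\mathcal{C}}(u)$. -}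

module Defs where

open import Data.Bool using (Bool; true; false; _∧_; _∨_; not; if_then_else_)
open import Data.Nat as ℕ using (ℕ; zero; suc)
open import Data.Integer using (+_)
open import Data.Fin using (Fin; _≟_)
open import Data.List using (List; foldr; allFin)
open import Data.Rational using (ℚ; 0ℚ; 1ℚ; _/_; _+_; _-_; _*_; _≤ᵇ_)
open import Relation.Binary.PropositionalEquality using (_≡_)
open import Data.Product using (Σ; _×_)
open import Relation.Nullary.Decidable using (⌊_⌋)

-- A complete graph on vertex set Fin n with every (ordered pair) edge labelled
-- positive (true) or negative (false); labels symmetric, positive self-loops.
record SignedGraph : Set where
  field
    n     : ℕ
    sign  : Fin n → Fin n → Bool
    symm  : ∀ u v → sign u v ≡ sign v u
    loops : ∀ u → sign u u ≡ true

count : {n : ℕ} → (Fin n → Bool) → ℕ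
count {n} P = foldr (λ w acc → if P w then suc acc else acc) 0 (allFin n)

sumℚ : {n : ℕ} → (Fin n → ℚ) → ℚ
sumℚ {n} g = foldr (λ w acc → g w + acc) 0ℚ (allFin n)

ℕtoℚ : ℕ → ℚ
ℕtoℚ k = + k / 1

-- a / b ; b is never 0 where used (unions contain u itself); 0 by convention
ratio : ℕ → ℕ → ℚ
ratio a zero    = 0ℚ
ratio a (suc m) = + a / suc m

module _ (G : SignedGraph) where
  open SignedGraph G

  Δ : Fin n → ℕ
  Δ u = count (λ w → sign u w)

  d : Fin n → Fin n → ℚ
  d u v = 1ℚ - ratio (count (λ w → sign u w ∧ sign v w))
                     (count (λ w → sign u w ∨ sign v w))

  seven-tenths : ℚ
  seven-tenths = + 7 / 10

  close : Fin n → Fin n → Bool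
  close u v = d u v ≤ᵇ seven-tenths

  heavy : Fin n → Bool
  heavy u = (10 ℕ.* Δ u) ℕ.≤ᵇ (3 ℕ.* count (λ v → not (sign u v) ∧ close u v))

  f : Fin n → Fin n → ℚ
  f u v =
    if (not ⌊ u ≟ v ⌋ ∧ (heavy u ∨ heavy v))
       ∨ (not (sign u v) ∧ not (close u v))
    then 1ℚ else d u v

  fracCost : ℚ
  fracCost = sumℚ (λ u → sumℚ (λ v → if sign u v then f u v else 0ℚ))
           + sumℚ (λ u → sumℚ (λ v → if sign u v then 0ℚ else (1ℚ - f u v)))

  -- clustering = labelling of vertices by cluster names (a partition of V)
  Clustering : Set
  Clustering = Fin n → Fin n

  y : Clustering → Fin n → ℕ
  y C u = count (λ v → if sign u v then not ⌊ C u ≟ C v ⌋ else ⌊ C u ≟ C v ⌋)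

  cost1 : Clustering → ℕ
  cost1 C = foldr (λ u acc → y C u ℕ.+ acc) 0 (allFin n)

  IsOPT1 : ℕ → Set
  IsOPT1 o = (Σ Clustering λ C → cost1 C ≡ o) × (∀ C → o ℕ.≤ cost1 C)

{-# OPTIONS --safe #-}
module Submission where

-- Fix any clustering C, let y_u be the number of its disagreements at u and r_u = y_u / Δ_u.
-- The ℓ₁ cost of f on a pair (u,v) is charged to the disagreement on (u,v) itself and to a
-- share of each endpoint.  A positive pair inside a cluster has d_uv ≤ r_u + r_v, since every
-- vertex of N_u⁺ ∪ N_v⁺ outside N_u⁺ ∩ N_v⁺ is a disagreement at u or at v; dually a negative
-- pair across clusters has 1 - d_uv = |N_u⁺ ∩ N_v⁺| / |N_u⁺ ∪ N_v⁺| ≤ r_u + r_v.  Pairs rounded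
-- up to 1 by a heavy endpoint are charged 1 to that endpoint.  Summed over v, the share of u is
-- y_u for positive pairs, plus at most 4 y_u for similar negative pairs when u is light, or Δ_u
-- when u is heavy.  If u is heavy and Δ_u > 10 y_u, most of its similar negative neighbours lie
-- in other clusters, and each of those has at least Δ_u / 5 disagreements inside the cluster of
-- u; double counting then bounds Δ_u by twice the mean of y over that cluster, and these means
-- sum to the cost of C.  Hence the fractional cost is at most 27 times the cost of any
-- clustering, in particular of an optimal one.

open import Defs
open import Algebra.Bundles using (Ring)
import Algebra.Properties.Semiring.Sum
open import Data.Bool using (Bool; true; false; if_then_else_; T; _∧_; _∨_; not)
import Data.Bool.Properties as Bool
open import Data.Empty using (⊥-elim)
open import Data.Fin using (Fin; zero; suc; _≟_)
import Data.Integer as ℤ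
import Data.Integer.Properties as ℤ
import Data.List as List
open import Data.List using (_∷_; [])
open import Data.Nat as ℕ using (ℕ; zero; suc; z≤n; s≤s)
import Data.Nat.Properties as ℕ
import Data.Nat.Tactic.RingSolver as ℕ
open import Data.Product using (Σ; _,_)
open import Data.Rational using (ℚ; 0ℚ; 1ℚ; _+_; _-_; _*_; _≤_; _<_; _≤ᵇ_; _/_; positive; nonNegative; toℚᵘ)
open import Data.Rational.Properties hiding (_≟_)
open import Data.Rational.Solver using (module +-*-Solver)
open import Data.Rational.Unnormalised as ℚᵘ using (mkℚᵘ; *≡*; _≃_)
import Data.Rational.Unnormalised.Properties as ℚᵘ
import Data.Vec.Functional as Vector
open import Function using (_∘_; id)
open import Relation.Binary.PropositionalEquality hiding ([_])
open import Relation.Nullary using (¬_; yes; no; contradiction)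
open import Relation.Nullary.Decidable using (⌊_⌋; toWitness; fromWitness; toWitnessFalse; fromWitnessFalse)

open import Algebra.Properties.Semiring.Sum (Ring.semiring +-*-ring)
  using (sum; sum-syntax; sum-cong-≗; ∑-distrib-+; ∑-comm; *-distribˡ-sum; *-distribʳ-sum)
module ℕΣ = Algebra.Properties.Semiring.Sum ℕ.+-*-semiring

-- Naturals and ratios inside ℚ

0≤1 : 0ℚ ≤ 1ℚ
0≤1 = <⇒≤ (positive⁻¹ 1ℚ)

≤-+-nonNegʳ : ∀ {x a b} → x ≤ a → 0ℚ ≤ b → x ≤ a + b
≤-+-nonNegʳ {x} x≤a 0≤b = subst (_≤ _) (+-identityʳ x) (+-mono-≤ x≤a 0≤b)

≤-+-nonNegˡ : ∀ {x a b} → 0ℚ ≤ a → x ≤ b → x ≤ a + b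
≤-+-nonNegˡ {x} 0≤a x≤b = subst (_≤ _) (+-identityˡ x) (+-mono-≤ 0≤a x≤b)

1-[1-p]≡p : ∀ p → 1ℚ - (1ℚ - p) ≡ p
1-[1-p]≡p = solve 1 (λ p → con 1ℚ :- (con 1ℚ :- p) := p) refl
  where open +-*-Solver

toℚᵘ-ℕtoℚ : ∀ k → toℚᵘ (ℕtoℚ k) ≃ mkℚᵘ (ℤ.+ k) 0
toℚᵘ-ℕtoℚ k = toℚᵘ-fromℚᵘ (mkℚᵘ (ℤ.+ k) 0)

ℕtoℚ-suc : ∀ k → ℕtoℚ (suc k) ≡ 1ℚ + ℕtoℚ k
ℕtoℚ-suc k = toℚᵘ-injective (begin
  toℚᵘ (ℕtoℚ (suc k))           ≈⟨ toℚᵘ-ℕtoℚ (suc k) ⟩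
  mkℚᵘ (ℤ.+ suc k) 0            ≈⟨ *≡* eq ⟩
  ℚᵘ.1ℚᵘ ℚᵘ.+ mkℚᵘ (ℤ.+ k) 0     ≈⟨ ℚᵘ.+-cong (toℚᵘ-ℕtoℚ 1) (toℚᵘ-ℕtoℚ k) ⟨
  toℚᵘ 1ℚ ℚᵘ.+ toℚᵘ (ℕtoℚ k)    ≈⟨ toℚᵘ-homo-+ 1ℚ (ℕtoℚ k) ⟨
  toℚᵘ (1ℚ + ℕtoℚ k)            ∎)
  where
  open ℚᵘ.≃-Reasoning
  eq : ℤ.+ suc k ℤ.* ℤ.+ 1 ≡ (ℤ.+ 1 ℤ.+ ℤ.+ k ℤ.* ℤ.+ 1) ℤ.* ℤ.+ 1
  eq rewrite ℤ.*-identityʳ (ℤ.+ k) | ℤ.*-identityʳ (ℤ.+ suc k) = refl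

ℕtoℚ-+ : ∀ a b → ℕtoℚ (a ℕ.+ b) ≡ ℕtoℚ a + ℕtoℚ b
ℕtoℚ-+ zero    b = sym (+-identityˡ (ℕtoℚ b))
ℕtoℚ-+ (suc a) b = begin
  ℕtoℚ (suc (a ℕ.+ b))      ≡⟨ ℕtoℚ-suc (a ℕ.+ b) ⟩
  1ℚ + ℕtoℚ (a ℕ.+ b)       ≡⟨ cong (1ℚ +_) (ℕtoℚ-+ a b) ⟩
  1ℚ + (ℕtoℚ a + ℕtoℚ b)    ≡⟨ +-assoc 1ℚ (ℕtoℚ a) (ℕtoℚ b) ⟨
  (1ℚ + ℕtoℚ a) + ℕtoℚ b    ≡⟨ cong (_+ ℕtoℚ b) (ℕtoℚ-suc a) ⟨
  ℕtoℚ (suc a) + ℕtoℚ b     ∎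
  where open ≡-Reasoning

ℕtoℚ-* : ∀ a b → ℕtoℚ (a ℕ.* b) ≡ ℕtoℚ a * ℕtoℚ b
ℕtoℚ-* zero    b = sym (*-zeroˡ (ℕtoℚ b))
ℕtoℚ-* (suc a) b = begin
  ℕtoℚ (b ℕ.+ a ℕ.* b)             ≡⟨ ℕtoℚ-+ b (a ℕ.* b) ⟩
  ℕtoℚ b + ℕtoℚ (a ℕ.* b)          ≡⟨ cong (ℕtoℚ b +_) (ℕtoℚ-* a b) ⟩
  ℕtoℚ b + ℕtoℚ a * ℕtoℚ b         ≡⟨ cong (_+ ℕtoℚ a * ℕtoℚ b) (*-identityˡ (ℕtoℚ b)) ⟨
  1ℚ * ℕtoℚ b + ℕtoℚ a * ℕtoℚ b    ≡⟨ *-distribʳ-+ (ℕtoℚ b) 1ℚ (ℕtoℚ a) ⟨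
  (1ℚ + ℕtoℚ a) * ℕtoℚ b           ≡⟨ cong (_* ℕtoℚ b) (ℕtoℚ-suc a) ⟨
  ℕtoℚ (suc a) * ℕtoℚ b            ∎
  where open ≡-Reasoning

ℕtoℚ-nonNeg : ∀ k → 0ℚ ≤ ℕtoℚ k
ℕtoℚ-nonNeg zero    = ≤-refl
ℕtoℚ-nonNeg (suc k) = subst (0ℚ ≤_) (sym (ℕtoℚ-suc k)) (+-mono-≤ 0≤1 (ℕtoℚ-nonNeg k))

ℕtoℚ-mono-≤ : ∀ {a b} → a ℕ.≤ b → ℕtoℚ a ≤ ℕtoℚ b
ℕtoℚ-mono-≤ {a} {b} a≤b = begin
  ℕtoℚ a                    ≡⟨ +-identityʳ (ℕtoℚ a) ⟨
  ℕtoℚ a + 0ℚ               ≤⟨ +-monoʳ-≤ (ℕtoℚ a) (ℕtoℚ-nonNeg (b ℕ.∸ a)) ⟩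
  ℕtoℚ a + ℕtoℚ (b ℕ.∸ a)   ≡⟨ ℕtoℚ-+ a (b ℕ.∸ a) ⟨
  ℕtoℚ (a ℕ.+ (b ℕ.∸ a))    ≡⟨ cong ℕtoℚ (ℕ.m+[n∸m]≡n a≤b) ⟩
  ℕtoℚ b                    ∎
  where open ≤-Reasoning

ℕtoℚ-mono-< : ∀ {a b} → a ℕ.< b → ℕtoℚ a < ℕtoℚ b
ℕtoℚ-mono-< {a} {suc b} (s≤s a≤b) = begin-strict
  ℕtoℚ a          ≡⟨ +-identityˡ (ℕtoℚ a) ⟨
  0ℚ + ℕtoℚ a     <⟨ +-mono-<-≤ (positive⁻¹ 1ℚ) (ℕtoℚ-mono-≤ a≤b) ⟩
  1ℚ + ℕtoℚ b     ≡⟨ ℕtoℚ-suc b ⟨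
  ℕtoℚ (suc b)    ∎
  where open ≤-Reasoning

ℕtoℚ-cancel-≤ : ∀ {a b} → ℕtoℚ a ≤ ℕtoℚ b → a ℕ.≤ b
ℕtoℚ-cancel-≤ le = ℕ.≮⇒≥ (λ b<a → <-irrefl refl (<-≤-trans (ℕtoℚ-mono-< b<a) le))

*-cancelʳ-≤-ℕtoℚ : ∀ {b x z} → 0 ℕ.< b → x * ℕtoℚ b ≤ z * ℕtoℚ b → x ≤ z
*-cancelʳ-≤-ℕtoℚ {b} 0<b = *-cancelʳ-≤-pos (ℕtoℚ b) {{positive (ℕtoℚ-mono-< 0<b)}}

ratio-*-den : ∀ a {b} → 0 ℕ.< b → ratio a b * ℕtoℚ b ≡ ℕtoℚ a
ratio-*-den a {suc m} _ = toℚᵘ-injective (begin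
  toℚᵘ (ratio a (suc m) * ℕtoℚ (suc m))             ≈⟨ toℚᵘ-homo-* (ratio a (suc m)) (ℕtoℚ (suc m)) ⟩
  toℚᵘ (ratio a (suc m)) ℚᵘ.* toℚᵘ (ℕtoℚ (suc m))   ≈⟨ ℚᵘ.*-cong (toℚᵘ-fromℚᵘ (mkℚᵘ (ℤ.+ a) m)) (toℚᵘ-ℕtoℚ (suc m)) ⟩
  mkℚᵘ (ℤ.+ a) m ℚᵘ.* mkℚᵘ (ℤ.+ suc m) 0            ≈⟨ *≡* eq ⟩
  mkℚᵘ (ℤ.+ a) 0                                    ≈⟨ toℚᵘ-ℕtoℚ a ⟨
  toℚᵘ (ℕtoℚ a)                                     ∎)
  where
  open ℚᵘ.≃-Reasoning
  eq : (ℤ.+ a ℤ.* ℤ.+ suc m) ℤ.* ℤ.+ 1 ≡ ℤ.+ a ℤ.* ℤ.+ (suc m ℕ.* 1)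
  eq rewrite ℤ.*-identityʳ (ℤ.+ a ℤ.* ℤ.+ suc m) | ℕ.*-identityʳ (suc m) = refl

ratio-≤ : ∀ {a b x} → 0 ℕ.< b → ℕtoℚ a ≤ x * ℕtoℚ b → ratio a b ≤ x
ratio-≤ {a} 0<b le = *-cancelʳ-≤-ℕtoℚ 0<b (subst (_≤ _) (sym (ratio-*-den a 0<b)) le)

≤-ratio : ∀ {a b x} → 0 ℕ.< b → x * ℕtoℚ b ≤ ℕtoℚ a → x ≤ ratio a b
≤-ratio {a} 0<b le = *-cancelʳ-≤-ℕtoℚ 0<b (subst (_ ≤_) (sym (ratio-*-den a 0<b)) le)

ratio-unique : ∀ {a b x} → 0 ℕ.< b → x * ℕtoℚ b ≡ ℕtoℚ a → ratio a b ≡ x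
ratio-unique 0<b eq = ≤-antisym (ratio-≤ 0<b (≤-reflexive (sym eq))) (≤-ratio 0<b (≤-reflexive eq))

ratio-nonNeg : ∀ a b → 0ℚ ≤ ratio a b
ratio-nonNeg a zero    = ≤-refl
ratio-nonNeg a (suc m) = ≤-ratio {a} (s≤s z≤n) (subst (_≤ ℕtoℚ a) (sym (*-zeroˡ (ℕtoℚ (suc m)))) (ℕtoℚ-nonNeg a))

ratio-self : ∀ {b} → 0 ℕ.< b → ratio b b ≡ 1ℚ
ratio-self {b} 0<b = ratio-unique 0<b (*-identityˡ (ℕtoℚ b))

ratio-+ : ∀ a c {b} → 0 ℕ.< b → ratio (a ℕ.+ c) b ≡ ratio a b + ratio c b
ratio-+ a c {b} 0<b = ratio-unique 0<b (begin
  (ratio a b + ratio c b) * ℕtoℚ b           ≡⟨ *-distribʳ-+ (ℕtoℚ b) (ratio a b) (ratio c b) ⟩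
  ratio a b * ℕtoℚ b + ratio c b * ℕtoℚ b    ≡⟨ cong₂ _+_ (ratio-*-den a 0<b) (ratio-*-den c 0<b) ⟩
  ℕtoℚ a + ℕtoℚ c                            ≡⟨ ℕtoℚ-+ a c ⟨
  ℕtoℚ (a ℕ.+ c)                             ∎)
  where open ≡-Reasoning

ratio-monoˡ-≤ : ∀ {a c b} → 0 ℕ.< b → a ℕ.≤ c → ratio a b ≤ ratio c b
ratio-monoˡ-≤ {a} {c} 0<b a≤c = ratio-≤ 0<b (subst (ℕtoℚ a ≤_) (sym (ratio-*-den c 0<b)) (ℕtoℚ-mono-≤ a≤c))

ratio-antimonoʳ-≤ : ∀ a {e b} → 0 ℕ.< e → e ℕ.≤ b → ratio a b ≤ ratio a e
ratio-antimonoʳ-≤ a {e} {b} 0<e e≤b = ratio-≤ (ℕ.<-≤-trans 0<e e≤b) (begin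
  ℕtoℚ a              ≡⟨ ratio-*-den a 0<e ⟨
  ratio a e * ℕtoℚ e  ≤⟨ *-monoˡ-≤-nonNeg (ratio a e) {{nonNegative (ratio-nonNeg a e)}} (ℕtoℚ-mono-≤ e≤b) ⟩
  ratio a e * ℕtoℚ b  ∎)
  where open ≤-Reasoning

ratio-≤-1 : ∀ {a b} → 0 ℕ.< b → a ℕ.≤ b → ratio a b ≤ 1ℚ
ratio-≤-1 {a} {b} 0<b a≤b = ratio-≤ 0<b (subst (ℕtoℚ a ≤_) (sym (*-identityˡ (ℕtoℚ b))) (ℕtoℚ-mono-≤ a≤b))

1-ratio : ∀ {a b} → 0 ℕ.< b → a ℕ.≤ b → 1ℚ - ratio a b ≡ ratio (b ℕ.∸ a) b
1-ratio {a} {b} 0<b a≤b = begin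
  1ℚ - ratio a b                               ≡⟨ cong (_- ratio a b) (ratio-self 0<b) ⟨
  ratio b b - ratio a b                        ≡⟨ cong (λ c → ratio c b - ratio a b) (ℕ.m∸n+n≡m a≤b) ⟨
  ratio (b ℕ.∸ a ℕ.+ a) b - ratio a b          ≡⟨ cong (_- ratio a b) (ratio-+ (b ℕ.∸ a) a 0<b) ⟩
  ratio (b ℕ.∸ a) b + ratio a b - ratio a b    ≡⟨ solve 2 (λ x y → x :+ y :- y := x) refl (ratio (b ℕ.∸ a) b) (ratio a b) ⟩
  ratio (b ℕ.∸ a) b                            ∎
  where
  open ≡-Reasoning
  open +-*-Solver

ratio-≤-+ : ∀ {x p q e₁ e₂ b} → x ℕ.≤ p ℕ.+ q → 0 ℕ.< e₁ → e₁ ℕ.≤ b → 0 ℕ.< e₂ → e₂ ℕ.≤ b →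
            ratio x b ≤ ratio p e₁ + ratio q e₂
ratio-≤-+ {x} {p} {q} {e₁} {e₂} {b} x≤p+q 0<e₁ e₁≤b 0<e₂ e₂≤b = begin
  ratio x b                ≤⟨ ratio-monoˡ-≤ 0<b x≤p+q ⟩
  ratio (p ℕ.+ q) b        ≡⟨ ratio-+ p q 0<b ⟩
  ratio p b + ratio q b    ≤⟨ +-mono-≤ (ratio-antimonoʳ-≤ p 0<e₁ e₁≤b) (ratio-antimonoʳ-≤ q 0<e₂ e₂≤b) ⟩
  ratio p e₁ + ratio q e₂  ∎
  where
  open ≤-Reasoning
  0<b = ℕ.<-≤-trans 0<e₁ e₁≤b

1-ratio≤7/10⇒3b≤10a : ∀ {a b} → 0 ℕ.< b → 1ℚ - ratio a b ≤ ℤ.+ 7 / 10 → 3 ℕ.* b ℕ.≤ 10 ℕ.* a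
1-ratio≤7/10⇒3b≤10a {a} {b} 0<b 1-ratio≤7/10 = ℕtoℚ-cancel-≤ (begin
  ℕtoℚ (3 ℕ.* b)                       ≡⟨ ℕtoℚ-* 3 b ⟩
  ℕtoℚ 10 * (ℤ.+ 3 / 10) * ℕtoℚ b      ≡⟨ *-assoc (ℕtoℚ 10) (ℤ.+ 3 / 10) (ℕtoℚ b) ⟩
  ℕtoℚ 10 * ((ℤ.+ 3 / 10) * ℕtoℚ b)    ≤⟨ *-monoˡ-≤-nonNeg (ℕtoℚ 10) {{nonNegative (ℕtoℚ-nonNeg 10)}}
                                            (*-monoʳ-≤-nonNeg (ℕtoℚ b) {{nonNegative (ℕtoℚ-nonNeg b)}} 3/10≤ratio) ⟩
  ℕtoℚ 10 * (ratio a b * ℕtoℚ b)       ≡⟨ cong (ℕtoℚ 10 *_) (ratio-*-den a 0<b) ⟩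
  ℕtoℚ 10 * ℕtoℚ a                     ≡⟨ ℕtoℚ-* 10 a ⟨
  ℕtoℚ (10 ℕ.* a)                      ∎)
  where
  open ≤-Reasoning
  3/10≤ratio : ℤ.+ 3 / 10 ≤ ratio a b
  3/10≤ratio = begin
    1ℚ - ℤ.+ 7 / 10          ≤⟨ +-monoʳ-≤ 1ℚ (neg-antimono-≤ 1-ratio≤7/10) ⟩
    1ℚ - (1ℚ - ratio a b)    ≡⟨ 1-[1-p]≡p (ratio a b) ⟩
    ratio a b                ∎

-- Sums and counts over Fin n

χ : Bool → ℕ
χ b = if b then 1 else 0

[_]·_ : Bool → ℚ → ℚ
[ b ]· x = if b then x else 0ℚ

foldr-tabulate : ∀ {A B C : Set} {m} (c : A → B → B) (g : C → A) (z : B) (h : Fin m → C) →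
                 List.foldr (λ w → c (g w)) z (List.tabulate h) ≡ Vector.foldr c z (g ∘ h)
foldr-tabulate {m = zero}  c g z h = refl
foldr-tabulate {m = suc m} c g z h = cong (c (g (h zero))) (foldr-tabulate c g z (h ∘ suc))

sumℚ≡∑ : ∀ {n} (g : Fin n → ℚ) → sumℚ g ≡ ∑[ w < n ] g w
sumℚ≡∑ g = foldr-tabulate _+_ g 0ℚ id

sumℚ²≡∑∑ : ∀ {n} (g : Fin n → Fin n → ℚ) → sumℚ (λ u → sumℚ (g u)) ≡ ∑[ u < n ] ∑[ v < n ] g u v
sumℚ²≡∑∑ g = trans (sumℚ≡∑ (λ u → sumℚ (g u))) (sum-cong-≗ (λ u → sumℚ≡∑ (g u)))

count≡∑χ : ∀ {n} (P : Fin n → Bool) → count P ≡ ℕΣ.sum (λ w → χ (P w))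
count≡∑χ P = trans (foldr-tabulate step P 0 id) (foldr-step P)
  where
  step : Bool → ℕ → ℕ
  step b acc = if b then suc acc else acc
  foldr-step : ∀ {m} (Q : Fin m → Bool) → Vector.foldr step 0 Q ≡ ℕΣ.sum (λ w → χ (Q w))
  foldr-step {zero}  Q = refl
  foldr-step {suc m} Q with Q zero
  ... | true  = cong suc (foldr-step (Q ∘ suc))
  ... | false = foldr-step (Q ∘ suc)

count-cong : ∀ {n} {P Q : Fin n → Bool} → (∀ w → P w ≡ Q w) → count P ≡ count Q
count-cong {P = P} {Q} P≗Q = begin
  count P                   ≡⟨ count≡∑χ P ⟩
  ℕΣ.sum (λ w → χ (P w))    ≡⟨ ℕΣ.sum-cong-≗ (λ w → cong χ (P≗Q w)) ⟩
  ℕΣ.sum (λ w → χ (Q w))    ≡⟨ count≡∑χ Q ⟨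
  count Q                   ∎
  where open ≡-Reasoning

χ-mono : ∀ {a b} → (T a → T b) → χ a ℕ.≤ χ b
χ-mono {false}         _   = z≤n
χ-mono {true}  {true}  _   = s≤s z≤n
χ-mono {true}  {false} a⇒b = ⊥-elim (a⇒b _)

χ-∨ : ∀ {a b c} → (T a → T (b ∨ c)) → χ a ℕ.≤ χ b ℕ.+ χ c
χ-∨ {false}                 _     = z≤n
χ-∨ {true}  {true}          _     = s≤s z≤n
χ-∨ {true}  {false} {true}  _     = s≤s z≤n
χ-∨ {true}  {false} {false} a⇒b∨c = ⊥-elim (a⇒b∨c _)

ℕΣ-mono-≤ : ∀ {n} {g h : Fin n → ℕ} → (∀ i → g i ℕ.≤ h i) → ℕΣ.sum g ℕ.≤ ℕΣ.sum h
ℕΣ-mono-≤ {zero}  _   = z≤n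
ℕΣ-mono-≤ {suc n} g≤h = ℕ.+-mono-≤ (g≤h zero) (ℕΣ-mono-≤ (g≤h ∘ suc))

∑-mono-≤ : ∀ {n} {g h : Fin n → ℚ} → (∀ i → g i ≤ h i) → ∑[ i < n ] g i ≤ ∑[ i < n ] h i
∑-mono-≤ {zero}  _   = ≤-refl
∑-mono-≤ {suc n} g≤h = +-mono-≤ (g≤h zero) (∑-mono-≤ (g≤h ∘ suc))

∑-nonNeg : ∀ {n} {g : Fin n → ℚ} → (∀ i → 0ℚ ≤ g i) → 0ℚ ≤ ∑[ i < n ] g i
∑-nonNeg {zero}  _   = ≤-refl
∑-nonNeg {suc n} 0≤g = +-mono-≤ (0≤g zero) (∑-nonNeg (0≤g ∘ suc))

∑∑-distrib-+ : ∀ {n} (g h : Fin n → Fin n → ℚ) →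
               ∑[ u < n ] ∑[ v < n ] (g u v + h u v) ≡ ∑[ u < n ] ∑[ v < n ] g u v + ∑[ u < n ] ∑[ v < n ] h u v
∑∑-distrib-+ g h = trans (sum-cong-≗ (λ u → ∑-distrib-+ (g u) (h u))) (∑-distrib-+ (λ u → sum (g u)) (λ u → sum (h u)))

ℕtoℚ-∑ : ∀ {n} (g : Fin n → ℕ) → ℕtoℚ (ℕΣ.sum g) ≡ ∑[ w < n ] ℕtoℚ (g w)
ℕtoℚ-∑ {zero}  g = refl
ℕtoℚ-∑ {suc n} g = trans (ℕtoℚ-+ (g zero) (ℕΣ.sum (g ∘ suc))) (cong (ℕtoℚ (g zero) +_) (ℕtoℚ-∑ (g ∘ suc)))

module _ {n : ℕ} where

  count-mono : ∀ {P Q : Fin n → Bool} → (∀ w → T (P w) → T (Q w)) → count P ℕ.≤ count Q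
  count-mono {P} {Q} P⇒Q = begin
    count P                   ≡⟨ count≡∑χ P ⟩
    ℕΣ.sum (λ w → χ (P w))    ≤⟨ ℕΣ-mono-≤ (λ w → χ-mono (P⇒Q w)) ⟩
    ℕΣ.sum (λ w → χ (Q w))    ≡⟨ count≡∑χ Q ⟨
    count Q                   ∎
    where open ℕ.≤-Reasoning

  count-∨ : ∀ {P Q R : Fin n → Bool} → (∀ w → T (P w) → T (Q w ∨ R w)) → count P ℕ.≤ count Q ℕ.+ count R
  count-∨ {P} {Q} {R} P⇒Q∨R = begin
    count P                                              ≡⟨ count≡∑χ P ⟩
    ℕΣ.sum (λ w → χ (P w))                               ≤⟨ ℕΣ-mono-≤ (λ w → χ-∨ {b = Q w} {c = R w} (P⇒Q∨R w)) ⟩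
    ℕΣ.sum (λ w → χ (Q w) ℕ.+ χ (R w))                   ≡⟨ ℕΣ.∑-distrib-+ (λ w → χ (Q w)) (λ w → χ (R w)) ⟩
    ℕΣ.sum (λ w → χ (Q w)) ℕ.+ ℕΣ.sum (λ w → χ (R w))    ≡⟨ cong₂ ℕ._+_ (count≡∑χ Q) (count≡∑χ R) ⟨
    count Q ℕ.+ count R                                  ∎
    where open ℕ.≤-Reasoning

  ℕtoℚ-count : (P : Fin n → Bool) → ℕtoℚ (count P) ≡ ∑[ w < n ] [ P w ]· 1ℚ
  ℕtoℚ-count P = begin
    ℕtoℚ (count P)                   ≡⟨ cong ℕtoℚ (count≡∑χ P) ⟩
    ℕtoℚ (ℕΣ.sum (λ w → χ (P w)))    ≡⟨ ℕtoℚ-∑ (λ w → χ (P w)) ⟩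
    ∑[ w < n ] ℕtoℚ (χ (P w))        ≡⟨ sum-cong-≗ (λ w → ℕtoℚ-χ (P w)) ⟩
    ∑[ w < n ] [ P w ]· 1ℚ           ∎
    where
    open ≡-Reasoning
    ℕtoℚ-χ : ∀ b → ℕtoℚ (χ b) ≡ [ b ]· 1ℚ
    ℕtoℚ-χ true  = refl
    ℕtoℚ-χ false = refl

  ∑-[]· : (P : Fin n → Bool) (c : ℚ) → ∑[ w < n ] [ P w ]· c ≡ ℕtoℚ (count P) * c
  ∑-[]· P c = begin
    ∑[ w < n ] [ P w ]· c            ≡⟨ sum-cong-≗ (λ w → []·≡[]·1* (P w)) ⟩
    ∑[ w < n ] ([ P w ]· 1ℚ * c)     ≡⟨ *-distribʳ-sum c (λ w → [ P w ]· 1ℚ) ⟨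
    (∑[ w < n ] [ P w ]· 1ℚ) * c     ≡⟨ cong (_* c) (ℕtoℚ-count P) ⟨
    ℕtoℚ (count P) * c               ∎
    where
    open ≡-Reasoning
    []·≡[]·1* : ∀ b → [ b ]· c ≡ [ b ]· 1ℚ * c
    []·≡[]·1* true  = sym (*-identityˡ c)
    []·≡[]·1* false = sym (*-zeroˡ c)

count-pos : ∀ {n} {P : Fin n → Bool} u → T (P u) → 0 ℕ.< count P
count-pos {suc n} {P} u Pu = begin
  1                                                         ≤⟨ χ-mono {true} {P u} (λ _ → Pu) ⟩
  χ (P u)                                                   ≤⟨ ℕ.m≤m+n (χ (P u)) _ ⟩
  χ (P u) ℕ.+ ℕΣ.sum (Vector.removeAt (λ w → χ (P w)) u)    ≡⟨ ℕΣ.sum-remove {i = u} (λ w → χ (P w)) ⟨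
  ℕΣ.sum (λ w → χ (P w))                                    ≡⟨ count≡∑χ P ⟨
  count P                                                   ∎
  where open ℕ.≤-Reasoning

[]·-nonNeg : ∀ b {x} → 0ℚ ≤ x → 0ℚ ≤ [ b ]· x
[]·-nonNeg true  0≤x = 0≤x
[]·-nonNeg false _   = ≤-refl

-- Charging the cost of one pair

T-∨-introˡ : ∀ a b → T a → T (a ∨ b)
T-∨-introˡ true b _ = _

T-∨-introʳ : ∀ a b → T b → T (a ∨ b)
T-∨-introʳ true  b _  = _
T-∨-introʳ false b Tb = Tb

T-∧-elimˡ : ∀ a b → T (a ∧ b) → T a
T-∧-elimˡ true b _ = _

T-∧-elimʳ : ∀ a b → T (a ∧ b) → T b
T-∧-elimʳ true b Tb = Tb

T-∧⇒T-∨ : ∀ a b → T (a ∧ b) → T (a ∨ b)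
T-∧⇒T-∨ true b _ = _

disagreement : (positive sameCluster : Bool) → Bool
disagreement s x = if s then not x else x

union⇒common∨disagreement : ∀ a b x → T (a ∨ b) → T ((a ∧ b) ∨ (disagreement a x ∨ disagreement b x))
union⇒common∨disagreement true  true  x     _ = _
union⇒common∨disagreement true  false true  _ = _
union⇒common∨disagreement true  false false _ = _
union⇒common∨disagreement false true  true  _ = _
union⇒common∨disagreement false true  false _ = _

same⇒positive∨disagreement : ∀ s x → T x → T (s ∨ disagreement s x)
same⇒positive∨disagreement true  x _  = _
same⇒positive∨disagreement false x Tx = Tx

negative⇒disagreement∨different : ∀ s c x → T (not s ∧ c) → T (disagreement s x ∨ ((not s ∧ c) ∧ not x))
negative⇒disagreement∨different false true true  _ = _
negative⇒disagreement∨different false true false _ = _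

edgeCost : (positive distinct heavyᵤ heavyᵥ close : Bool) → ℚ → ℚ
edgeCost s distinct hu hv cl δ = if s then φ else 1ℚ - φ
  where φ = if (distinct ∧ (hu ∨ hv)) ∨ (not s ∧ not cl) then 1ℚ else δ

share : (positive heavy close : Bool) → ℚ → ℚ
share s h cl r = [ s ]· r + (if h then [ s ]· 1ℚ else [ not s ∧ cl ]· r)

share-nonNeg : ∀ s h cl {r} → 0ℚ ≤ r → 0ℚ ≤ share s h cl r
share-nonNeg s true  cl 0≤r = +-mono-≤ ([]·-nonNeg s 0≤r) ([]·-nonNeg s 0≤1)
share-nonNeg s false cl 0≤r = +-mono-≤ ([]·-nonNeg s 0≤r) ([]·-nonNeg (not s ∧ cl) 0≤r)

share-positive : ∀ h cl {r} → r ≤ share true h cl r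
share-positive true  cl = ≤-+-nonNegʳ ≤-refl 0≤1
share-positive false cl = ≤-reflexive (sym (+-identityʳ _))

share-heavy : ∀ cl {r} → 0ℚ ≤ r → 1ℚ ≤ share true true cl r
share-heavy cl 0≤r = ≤-+-nonNegˡ 0≤r ≤-refl

shares-nonNeg : ∀ s hu hv cl {ru rv} → 0ℚ ≤ ru → 0ℚ ≤ rv → 0ℚ ≤ share s hu cl ru + share s hv cl rv
shares-nonNeg s hu hv cl 0≤ru 0≤rv = +-mono-≤ (share-nonNeg s hu cl 0≤ru) (share-nonNeg s hv cl 0≤rv)

positive-unrounded-≤ : ∀ hu hv cl x {δ ru rv} → δ ≤ 1ℚ → 0ℚ ≤ ru → 0ℚ ≤ rv → (T x → δ ≤ ru + rv) →
             δ ≤ [ not x ]· 1ℚ + (share true hu cl ru + share true hv cl rv)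
positive-unrounded-≤ hu hv cl true  {ru = ru} {rv} _ _ _ within =
  ≤-+-nonNegˡ ≤-refl (≤-trans (within _) (+-mono-≤ (share-positive hu cl {ru}) (share-positive hv cl {rv})))
positive-unrounded-≤ hu hv cl false δ≤1 0≤ru 0≤rv _ = ≤-+-nonNegʳ δ≤1 (shares-nonNeg true hu hv cl 0≤ru 0≤rv)

edgeCost-≤ : ∀ s distinct hu hv cl x {δ ru rv} → 0ℚ ≤ δ → δ ≤ 1ℚ → 0ℚ ≤ ru → 0ℚ ≤ rv →
             (T (not s) → T distinct) → (T x → δ ≤ ru + rv) → (T (not x) → 1ℚ - δ ≤ ru + rv) →
             edgeCost s distinct hu hv cl δ ≤ [ disagreement s x ]· 1ℚ + (share s hu cl ru + share s hv cl rv)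
edgeCost-≤ true  true  true  hv    cl    x     _   _   0≤ru 0≤rv _ _ _ =
  ≤-+-nonNegˡ ([]·-nonNeg (not x) 0≤1) (≤-+-nonNegʳ (share-heavy cl 0≤ru) (share-nonNeg true hv cl 0≤rv))
edgeCost-≤ true  true  false true  cl    x     _   _   0≤ru 0≤rv _ _ _ =
  ≤-+-nonNegˡ ([]·-nonNeg (not x) 0≤1) (≤-+-nonNegˡ (share-nonNeg true false cl 0≤ru) (share-heavy cl 0≤rv))
edgeCost-≤ true  true  false false cl    x     _   δ≤1 0≤ru 0≤rv _ within _ = positive-unrounded-≤ false false cl x δ≤1 0≤ru 0≤rv within
edgeCost-≤ true  false hu    hv    cl    x     _   δ≤1 0≤ru 0≤rv _ within _ = positive-unrounded-≤ hu hv cl x δ≤1 0≤ru 0≤rv within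
edgeCost-≤ false false hu    hv    cl    x     _   _   _    _    distinct _ _ = ⊥-elim (distinct _)
-- f rounds the next three negative pairs to 1, so their cost 1ℚ - 1ℚ reduces to 0ℚ.
edgeCost-≤ false true  true  hv    cl    x     _   _   0≤ru 0≤rv _ _ _ =
  ≤-+-nonNegˡ ([]·-nonNeg x 0≤1) (shares-nonNeg false true hv cl 0≤ru 0≤rv)
edgeCost-≤ false true  false true  cl    x     _   _   0≤ru 0≤rv _ _ _ =
  ≤-+-nonNegˡ ([]·-nonNeg x 0≤1) (shares-nonNeg false false true cl 0≤ru 0≤rv)
edgeCost-≤ false true  false false false x     _   _   0≤ru 0≤rv _ _ _ =
  ≤-+-nonNegˡ ([]·-nonNeg x 0≤1) (shares-nonNeg false false false false 0≤ru 0≤rv)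
edgeCost-≤ false true  false false true  true  0≤δ _   0≤ru 0≤rv _ _ _ =
  ≤-+-nonNegʳ (+-monoʳ-≤ 1ℚ (neg-antimono-≤ 0≤δ)) (shares-nonNeg false false false true 0≤ru 0≤rv)
edgeCost-≤ false true  false false true  false {δ} {ru} {rv} _ _ _ _ _ _ across =
  ≤-+-nonNegˡ ≤-refl (subst₂ (λ a b → 1ℚ - δ ≤ a + b) (sym (+-identityˡ ru)) (sym (+-identityˡ rv)) (across _))

-- The arithmetic of a heavy vertex u with 10 y_u < Δ_u, where D = Δ_u, y = y_u, m and f count the
-- similar negative neighbours of u and those of them in other clusters, and k and Y are the size
-- and the cost of the cluster of u.

heavy-far-arith : ∀ {D y m f} → 10 ℕ.* D ℕ.≤ 3 ℕ.* m → m ℕ.≤ y ℕ.+ f → 10 ℕ.* y ℕ.< D → 3 ℕ.* D ℕ.≤ f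
heavy-far-arith {D} {y} {m} {f} 10D≤3m m≤y+f 10y<D = ℕ.<⇒≤ (ℕ.*-cancelˡ-< 3 _ _ (ℕ.+-cancelˡ-< D _ _ (begin-strict
  D ℕ.+ 3 ℕ.* (3 ℕ.* D)    ≡⟨ ℕ.solve (D ∷ []) ⟩
  10 ℕ.* D                 ≤⟨ 10D≤3m ⟩
  3 ℕ.* m                  ≤⟨ ℕ.*-monoʳ-≤ 3 m≤y+f ⟩
  3 ℕ.* (y ℕ.+ f)          ≡⟨ ℕ.*-distribˡ-+ 3 y f ⟩
  3 ℕ.* y ℕ.+ 3 ℕ.* f      <⟨ ℕ.+-monoˡ-< (3 ℕ.* f) (ℕ.≤-<-trans (ℕ.*-monoˡ-≤ y {3} {10} (ℕ.m≤m+n 3 7)) 10y<D) ⟩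
  D ℕ.+ 3 ℕ.* f            ∎)))
  where open ℕ.≤-Reasoning

heavy-size-arith : ∀ {D y f k Y} → 3 ℕ.* D ℕ.≤ f → D ℕ.* f ℕ.≤ 5 ℕ.* Y → k ℕ.≤ D ℕ.+ y → 10 ℕ.* y ℕ.< D →
                   D ℕ.* k ℕ.≤ 2 ℕ.* Y
heavy-size-arith {D} {y} {f} {k} {Y} 3D≤f Df≤5Y k≤D+y 10y<D = ℕ.*-cancelˡ-≤ 30 (begin
  30 ℕ.* (D ℕ.* k)          ≡⟨ ℕ.solve (D ∷ k ∷ []) ⟩
  3 ℕ.* D ℕ.* (10 ℕ.* k)    ≤⟨ ℕ.*-monoʳ-≤ (3 ℕ.* D) 10k≤11D ⟩
  3 ℕ.* D ℕ.* (11 ℕ.* D)    ≡⟨ ℕ.solve (D ∷ []) ⟩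
  11 ℕ.* (3 ℕ.* D ℕ.* D)    ≤⟨ ℕ.*-monoʳ-≤ 11 (ℕ.*-monoˡ-≤ D 3D≤f) ⟩
  11 ℕ.* (f ℕ.* D)          ≡⟨ cong (11 ℕ.*_) (ℕ.*-comm f D) ⟩
  11 ℕ.* (D ℕ.* f)          ≤⟨ ℕ.*-monoʳ-≤ 11 Df≤5Y ⟩
  11 ℕ.* (5 ℕ.* Y)          ≤⟨ ℕ.*-monoˡ-≤ (5 ℕ.* Y) {11} {12} (ℕ.n≤1+n 11) ⟩
  12 ℕ.* (5 ℕ.* Y)          ≡⟨ ℕ.solve (Y ∷ []) ⟩
  30 ℕ.* (2 ℕ.* Y)          ∎)
  where
  open ℕ.≤-Reasoning
  10k≤11D : 10 ℕ.* k ℕ.≤ 11 ℕ.* D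
  10k≤11D = begin
    10 ℕ.* k                 ≤⟨ ℕ.*-monoʳ-≤ 10 k≤D+y ⟩
    10 ℕ.* (D ℕ.+ y)         ≡⟨ ℕ.*-distribˡ-+ 10 D y ⟩
    10 ℕ.* D ℕ.+ 10 ℕ.* y    ≤⟨ ℕ.+-monoʳ-≤ (10 ℕ.* D) (ℕ.<⇒≤ 10y<D) ⟩
    10 ℕ.* D ℕ.+ D           ≡⟨ ℕ.solve (D ∷ []) ⟩
    11 ℕ.* D                 ∎

-- Charging the fractional cost to a clustering

module Charging (G : SignedGraph) (C : Clustering G) where
  open SignedGraph G

  same : Fin n → Fin n → Bool
  same u w = ⌊ C u ≟ C w ⌋

  disagree : Fin n → Fin n → Bool
  disagree u w = disagreement (sign u w) (same u w)

  common union : Fin n → Fin n → ℕ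
  common u v = count (λ w → sign u w ∧ sign v w)
  union  u v = count (λ w → sign u w ∨ sign v w)

  r : Fin n → ℚ
  r u = ratio (y G C u) (Δ G u)

  similarNegative far : Fin n → Fin n → Bool
  similarNegative u v = not (sign u v) ∧ close G u v
  far u v = similarNegative u v ∧ not (same u v)

  clusterSize : Fin n → ℕ
  clusterSize u = count (same u)

  clusterCost : Fin n → ℕ
  clusterCost u = ℕΣ.sum (λ w → if same u w then y G C w else 0)

  clusterMean : Fin n → ℚ
  clusterMean u = ∑[ w < n ] [ same u w ]· ratio (y G C w) (clusterSize u)

  clusterDisagreements : Fin n → Fin n → ℕ
  clusterDisagreements u v = count (λ w → same u w ∧ disagree v w)

  same-cong : ∀ {u v} → C u ≡ C v → ∀ w → same u w ≡ same v w
  same-cong Cu≡Cv w = cong (λ c → ⌊ c ≟ C w ⌋) Cu≡Cv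

  same-sym : ∀ u v → same u v ≡ same v u
  same-sym u v with C u ≟ C v | C v ≟ C u
  ... | yes _  | yes _ = refl
  ... | no  _  | no  _ = refl
  ... | yes p  | no ¬q = contradiction (sym p) ¬q
  ... | no ¬p  | yes q = contradiction (sym q) ¬p

  disagree-sym : ∀ u v → disagree u v ≡ disagree v u
  disagree-sym u v rewrite symm u v | same-sym u v = refl

  close-sym : ∀ u v → close G u v ≡ close G v u
  close-sym u v = cong (_≤ᵇ ℤ.+ 7 / 10) (cong₂ (λ a b → 1ℚ - ratio a b)
    (count-cong (λ w → Bool.∧-comm (sign u w) (sign v w))) (count-cong (λ w → Bool.∨-comm (sign u w) (sign v w))))

  Δ-pos : ∀ u → 0 ℕ.< Δ G u
  Δ-pos u = count-pos u (subst T (sym (loops u)) _)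

  Δ≤unionˡ : ∀ u v → Δ G u ℕ.≤ union u v
  Δ≤unionˡ u v = count-mono (λ w → T-∨-introˡ (sign u w) (sign v w))

  Δ≤unionʳ : ∀ u v → Δ G v ℕ.≤ union u v
  Δ≤unionʳ u v = count-mono (λ w → T-∨-introʳ (sign u w) (sign v w))

  common≤union : ∀ u v → common u v ℕ.≤ union u v
  common≤union u v = count-mono (λ w → T-∧⇒T-∨ (sign u w) (sign v w))

  union-pos : ∀ u v → 0 ℕ.< union u v
  union-pos u v = ℕ.<-≤-trans (Δ-pos u) (Δ≤unionˡ u v)

  union≤common+y : ∀ {u v} → C u ≡ C v → union u v ℕ.≤ common u v ℕ.+ (y G C u ℕ.+ y G C v)
  union≤common+y {u} {v} Cu≡Cv =
    ℕ.≤-trans (count-∨ covered) (ℕ.+-monoʳ-≤ (common u v) (count-∨ {Q = disagree u} {R = disagree v} (λ _ → id)))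
    where
    covered : ∀ w → T (sign u w ∨ sign v w) → T ((sign u w ∧ sign v w) ∨ (disagree u w ∨ disagree v w))
    covered w rewrite same-cong Cu≡Cv w = union⇒common∨disagreement (sign u w) (sign v w) (same v w)

  common≤clusterDisagreements+y : ∀ {u v} → ¬ C u ≡ C v → common u v ℕ.≤ clusterDisagreements u v ℕ.+ y G C u
  common≤clusterDisagreements+y {u} {v} Cu≢Cv = count-∨ covered
    where
    covered : ∀ w → T (sign u w ∧ sign v w) → T ((same u w ∧ disagree v w) ∨ disagree u w)
    covered w _  with sign u w | sign v w | C u ≟ C w | C v ≟ C w
    covered w () | false | _     | _     | _
    covered w () | true  | false | _     | _
    ... | true | true | no _  | _     = _
    ... | true | true | yes _ | no _  = _
    ... | true | true | yes p | yes q = contradiction (trans p (sym q)) Cu≢Cv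

  clusterDisagreements≤y : ∀ u v → clusterDisagreements u v ℕ.≤ y G C v
  clusterDisagreements≤y u v = count-mono (λ w → T-∧-elimʳ (same u w) (disagree v w))

  common≤y+y : ∀ {u v} → ¬ C u ≡ C v → common u v ℕ.≤ y G C u ℕ.+ y G C v
  common≤y+y {u} {v} Cu≢Cv = begin
    common u v                                ≤⟨ common≤clusterDisagreements+y Cu≢Cv ⟩
    clusterDisagreements u v ℕ.+ y G C u      ≤⟨ ℕ.+-monoˡ-≤ (y G C u) (clusterDisagreements≤y u v) ⟩
    y G C v ℕ.+ y G C u                       ≡⟨ ℕ.+-comm (y G C v) (y G C u) ⟩
    y G C u ℕ.+ y G C v                       ∎
    where open ℕ.≤-Reasoning

  r-nonNeg : ∀ u → 0ℚ ≤ r u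
  r-nonNeg u = ratio-nonNeg (y G C u) (Δ G u)

  Δ*r≡y : ∀ u → ℕtoℚ (Δ G u) * r u ≡ ℕtoℚ (y G C u)
  Δ*r≡y u = trans (*-comm (ℕtoℚ (Δ G u)) (r u)) (ratio-*-den (y G C u) (Δ-pos u))

  d-nonNeg : ∀ u v → 0ℚ ≤ d G u v
  d-nonNeg u v = +-monoʳ-≤ 1ℚ (neg-antimono-≤ (ratio-≤-1 (union-pos u v) (common≤union u v)))

  d-≤-1 : ∀ u v → d G u v ≤ 1ℚ
  d-≤-1 u v = +-monoʳ-≤ 1ℚ (neg-antimono-≤ (ratio-nonNeg (common u v) (union u v)))

  d-within : ∀ {u v} → C u ≡ C v → d G u v ≤ r u + r v
  d-within {u} {v} Cu≡Cv = begin
    1ℚ - ratio (common u v) (union u v)             ≡⟨ 1-ratio (union-pos u v) (common≤union u v) ⟩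
    ratio (union u v ℕ.∸ common u v) (union u v)    ≤⟨ ratio-≤-+ (ℕ.m≤n+o⇒m∸n≤o (union u v) (common u v) (union≤common+y Cu≡Cv))
                                                         (Δ-pos u) (Δ≤unionˡ u v) (Δ-pos v) (Δ≤unionʳ u v) ⟩
    r u + r v                                       ∎
    where open ≤-Reasoning

  1-d-across : ∀ {u v} → ¬ C u ≡ C v → 1ℚ - d G u v ≤ r u + r v
  1-d-across {u} {v} Cu≢Cv = begin
    1ℚ - (1ℚ - ratio (common u v) (union u v))    ≡⟨ 1-[1-p]≡p (ratio (common u v) (union u v)) ⟩
    ratio (common u v) (union u v)                ≤⟨ ratio-≤-+ (common≤y+y Cu≢Cv) (Δ-pos u) (Δ≤unionˡ u v) (Δ-pos v) (Δ≤unionʳ u v) ⟩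
    r u + r v                                     ∎
    where open ≤-Reasoning

  pairCost : Fin n → Fin n → ℚ
  pairCost u v = edgeCost (sign u v) (not ⌊ u ≟ v ⌋) (heavy G u) (heavy G v) (close G u v) (d G u v)

  charge : Fin n → Fin n → ℚ
  charge u v = share (sign u v) (heavy G u) (close G u v) (r u)

  pairCost-≤ : ∀ u v → pairCost u v ≤ [ disagree u v ]· 1ℚ + (charge u v + charge v u)
  pairCost-≤ u v = subst (λ c → pairCost u v ≤ [ disagree u v ]· 1ℚ + (charge u v + c))
    (cong₂ (λ s cl → share s (heavy G v) cl (r v)) (symm u v) (close-sym u v))
    (edgeCost-≤ (sign u v) (not ⌊ u ≟ v ⌋) (heavy G u) (heavy G v) (close G u v) (same u v)
      (d-nonNeg u v) (d-≤-1 u v) (r-nonNeg u) (r-nonNeg v) negative⇒distinct (d-within ∘ toWitness) (1-d-across ∘ toWitnessFalse))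
    where
    negative⇒distinct : T (not (sign u v)) → T (not ⌊ u ≟ v ⌋)
    negative⇒distinct negative = fromWitnessFalse λ { refl → subst (T ∘ not) (loops u) negative }

  clusterSize-pos : ∀ u → 0 ℕ.< clusterSize u
  clusterSize-pos u = count-pos u (fromWitness refl)

  clusterSize-cong : ∀ {u w} → C u ≡ C w → clusterSize u ≡ clusterSize w
  clusterSize-cong Cu≡Cw = count-cong (same-cong Cu≡Cw)

  clusterSize≤Δ+y : ∀ u → clusterSize u ℕ.≤ Δ G u ℕ.+ y G C u
  clusterSize≤Δ+y u = count-∨ (λ w → same⇒positive∨disagreement (sign u w) (same u w))

  similarNegative≤y+far : ∀ u → count (similarNegative u) ℕ.≤ y G C u ℕ.+ count (far u)
  similarNegative≤y+far u = count-∨ (λ v → negative⇒disagreement∨different (sign u v) (close G u v) (same u v))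

  far⇒Δ≤5*clusterDisagreements : ∀ {u v} → T (far u v) → 10 ℕ.* y G C u ℕ.< Δ G u →
                                 Δ G u ℕ.≤ 5 ℕ.* clusterDisagreements u v
  far⇒Δ≤5*clusterDisagreements {u} {v} far-uv 10y<Δ =
    ℕ.*-cancelˡ-≤ 2 (ℕ.<⇒≤ (ℕ.+-cancelˡ-< D (2 ℕ.* D) (2 ℕ.* (5 ℕ.* E)) (begin-strict
    D ℕ.+ 2 ℕ.* D                  ≡⟨⟩
    3 ℕ.* D                        ≤⟨ ℕ.*-monoʳ-≤ 3 (Δ≤unionˡ u v) ⟩
    3 ℕ.* union u v                ≤⟨ 1-ratio≤7/10⇒3b≤10a (union-pos u v) (≤ᵇ⇒≤ close-uv) ⟩
    10 ℕ.* common u v              ≤⟨ ℕ.*-monoʳ-≤ 10 (common≤clusterDisagreements+y (toWitnessFalse different)) ⟩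
    10 ℕ.* (E ℕ.+ y G C u)         ≡⟨ ℕ.*-distribˡ-+ 10 E (y G C u) ⟩
    10 ℕ.* E ℕ.+ 10 ℕ.* y G C u    <⟨ ℕ.+-monoʳ-< (10 ℕ.* E) 10y<Δ ⟩
    10 ℕ.* E ℕ.+ D                 ≡⟨ ℕ.+-comm (10 ℕ.* E) D ⟩
    D ℕ.+ 10 ℕ.* E                 ≡⟨ cong (D ℕ.+_) (ℕ.*-assoc 2 5 E) ⟩
    D ℕ.+ 2 ℕ.* (5 ℕ.* E)          ∎)))
    where
    open ℕ.≤-Reasoning
    D = Δ G u
    E = clusterDisagreements u v
    close-uv = T-∧-elimʳ (not (sign u v)) (close G u v) (T-∧-elimˡ (similarNegative u v) (not (same u v)) far-uv)
    different = T-∧-elimʳ (similarNegative u v) (not (same u v)) far-uv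

  ∑clusterDisagreements≡clusterCost : ∀ u → ℕΣ.sum (clusterDisagreements u) ≡ clusterCost u
  ∑clusterDisagreements≡clusterCost u = begin
    ℕΣ.sum (clusterDisagreements u)                  ≡⟨ ℕΣ.sum-cong-≗ (λ v → count≡∑χ (λ w → same u w ∧ disagree v w)) ⟩
    ℕΣ.sum (λ v → ℕΣ.sum (λ w → χ (incident v w)))   ≡⟨ ℕΣ.∑-comm (λ v w → χ (incident v w)) ⟩
    ℕΣ.sum (λ w → ℕΣ.sum (λ v → χ (incident v w)))   ≡⟨ ℕΣ.sum-cong-≗ column ⟩
    clusterCost u                                    ∎
    where
    open ≡-Reasoning
    incident : Fin n → Fin n → Bool
    incident v w = same u w ∧ disagree v w
    column : ∀ w → ℕΣ.sum (λ v → χ (incident v w)) ≡ (if same u w then y G C w else 0)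
    column w with same u w
    ... | true  = trans (ℕΣ.sum-cong-≗ (λ v → cong χ (disagree-sym v w))) (sym (count≡∑χ (disagree w)))
    ... | false = ℕΣ.sum-replicate-zero n

  Δ*far≤5*clusterCost : ∀ u → 10 ℕ.* y G C u ℕ.< Δ G u → Δ G u ℕ.* count (far u) ℕ.≤ 5 ℕ.* clusterCost u
  Δ*far≤5*clusterCost u 10y<Δ = begin
    Δ G u ℕ.* count (far u)                          ≡⟨ cong (Δ G u ℕ.*_) (count≡∑χ (far u)) ⟩
    Δ G u ℕ.* ℕΣ.sum (λ v → χ (far u v))             ≡⟨ ℕΣ.*-distribˡ-sum (Δ G u) (λ v → χ (far u v)) ⟩
    ℕΣ.sum (λ v → Δ G u ℕ.* χ (far u v))             ≤⟨ ℕΣ-mono-≤ termwise ⟩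
    ℕΣ.sum (λ v → 5 ℕ.* clusterDisagreements u v)    ≡⟨ ℕΣ.*-distribˡ-sum 5 (clusterDisagreements u) ⟨
    5 ℕ.* ℕΣ.sum (clusterDisagreements u)            ≡⟨ cong (5 ℕ.*_) (∑clusterDisagreements≡clusterCost u) ⟩
    5 ℕ.* clusterCost u                              ∎
    where
    open ℕ.≤-Reasoning
    termwise : ∀ v → Δ G u ℕ.* χ (far u v) ℕ.≤ 5 ℕ.* clusterDisagreements u v
    termwise v with far u v in far-uv
    ... | true  = subst (ℕ._≤ 5 ℕ.* clusterDisagreements u v) (sym (ℕ.*-identityʳ (Δ G u)))
                        (far⇒Δ≤5*clusterDisagreements (subst T (sym far-uv) _) 10y<Δ)
    ... | false = subst (ℕ._≤ 5 ℕ.* clusterDisagreements u v) (sym (ℕ.*-zeroʳ (Δ G u))) z≤n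

  heavy⇒Δ*clusterSize≤2*clusterCost : ∀ u → T (heavy G u) → 10 ℕ.* y G C u ℕ.< Δ G u →
                                      Δ G u ℕ.* clusterSize u ℕ.≤ 2 ℕ.* clusterCost u
  heavy⇒Δ*clusterSize≤2*clusterCost u heavy-u 10y<Δ =
    heavy-size-arith {f = count (far u)} {Y = clusterCost u}
      (heavy-far-arith {m = count (similarNegative u)} (ℕ.≤ᵇ⇒≤ _ _ heavy-u) (similarNegative≤y+far u) 10y<Δ)
      (Δ*far≤5*clusterCost u 10y<Δ) (clusterSize≤Δ+y u) 10y<Δ

  clusterCost≡clusterMean*clusterSize : ∀ u → ℕtoℚ (clusterCost u) ≡ clusterMean u * ℕtoℚ (clusterSize u)
  clusterCost≡clusterMean*clusterSize u = begin
    ℕtoℚ (clusterCost u)                                        ≡⟨ ℕtoℚ-∑ (λ w → if same u w then y G C w else 0) ⟩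
    ∑[ w < n ] ℕtoℚ (if same u w then y G C w else 0)           ≡⟨ sum-cong-≗ termwise ⟩
    ∑[ w < n ] ([ same u w ]· ratio (y G C w) k * ℕtoℚ k)       ≡⟨ *-distribʳ-sum (ℕtoℚ k) (λ w → [ same u w ]· ratio (y G C w) k) ⟨
    clusterMean u * ℕtoℚ k                                      ∎
    where
    open ≡-Reasoning
    k = clusterSize u
    termwise : ∀ w → ℕtoℚ (if same u w then y G C w else 0) ≡ [ same u w ]· ratio (y G C w) k * ℕtoℚ k
    termwise w with same u w
    ... | true  = sym (ratio-*-den (y G C w) (clusterSize-pos u))
    ... | false = sym (*-zeroˡ (ℕtoℚ k))

  2*clusterMean-nonNeg : ∀ u → 0ℚ ≤ ℕtoℚ 2 * clusterMean u
  2*clusterMean-nonNeg u = *-monoˡ-≤-nonNeg (ℕtoℚ 2) {{nonNegative (ℕtoℚ-nonNeg 2)}}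
    (∑-nonNeg (λ w → []·-nonNeg (same u w) (ratio-nonNeg (y G C w) (clusterSize u))))

  heavy⇒Δ≤10y+2*clusterMean : ∀ u → T (heavy G u) → ℕtoℚ (Δ G u) ≤ ℕtoℚ (10 ℕ.* y G C u) + ℕtoℚ 2 * clusterMean u
  heavy⇒Δ≤10y+2*clusterMean u heavy-u with Δ G u ℕ.≤? 10 ℕ.* y G C u
  ... | yes Δ≤10y = ≤-+-nonNegʳ (ℕtoℚ-mono-≤ Δ≤10y) (2*clusterMean-nonNeg u)
  ... | no  Δ≰10y = ≤-+-nonNegˡ (ℕtoℚ-nonNeg (10 ℕ.* y G C u)) (*-cancelʳ-≤-ℕtoℚ (clusterSize-pos u) (begin
    ℕtoℚ (Δ G u) * ℕtoℚ k          ≡⟨ ℕtoℚ-* (Δ G u) k ⟨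
    ℕtoℚ (Δ G u ℕ.* k)             ≤⟨ ℕtoℚ-mono-≤ (heavy⇒Δ*clusterSize≤2*clusterCost u heavy-u (ℕ.≰⇒> Δ≰10y)) ⟩
    ℕtoℚ (2 ℕ.* clusterCost u)     ≡⟨ ℕtoℚ-* 2 (clusterCost u) ⟩
    ℕtoℚ 2 * ℕtoℚ (clusterCost u)  ≡⟨ cong (ℕtoℚ 2 *_) (clusterCost≡clusterMean*clusterSize u) ⟩
    ℕtoℚ 2 * (clusterMean u * ℕtoℚ k) ≡⟨ *-assoc (ℕtoℚ 2) (clusterMean u) (ℕtoℚ k) ⟨
    ℕtoℚ 2 * clusterMean u * ℕtoℚ k   ∎))
    where
    open ≤-Reasoning
    k = clusterSize u

  light⇒similarNegative≤4Δ : ∀ u → ¬ T (heavy G u) → count (similarNegative u) ℕ.≤ 4 ℕ.* Δ G u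
  light⇒similarNegative≤4Δ u light = ℕ.<⇒≤ (ℕ.*-cancelˡ-< 3 _ _ (begin-strict
    3 ℕ.* count (similarNegative u)    <⟨ ℕ.≰⇒> (light ∘ ℕ.≤⇒≤ᵇ) ⟩
    10 ℕ.* Δ G u                       ≤⟨ ℕ.*-monoˡ-≤ (Δ G u) {10} {12} (ℕ.m≤m+n 10 2) ⟩
    3 ℕ.* 4 ℕ.* Δ G u                  ≡⟨ ℕ.*-assoc 3 4 (Δ G u) ⟩
    3 ℕ.* (4 ℕ.* Δ G u)                ∎))
    where open ℕ.≤-Reasoning

  ∑charge≤ : ∀ u → ∑[ v < n ] charge u v ≤ ℕtoℚ (y G C u) + (ℕtoℚ (10 ℕ.* y G C u) + ℕtoℚ 2 * clusterMean u)
  ∑charge≤ u = begin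
    ∑[ v < n ] charge u v                                    ≡⟨ ∑-distrib-+ (λ v → [ sign u v ]· r u) heavyPart ⟩
    ∑[ v < n ] [ sign u v ]· r u + ∑[ v < n ] heavyPart v    ≡⟨ cong (_+ ∑[ v < n ] heavyPart v) (trans (∑-[]· (sign u) (r u)) (Δ*r≡y u)) ⟩
    ℕtoℚ (y G C u) + ∑[ v < n ] heavyPart v                  ≤⟨ +-monoʳ-≤ (ℕtoℚ (y G C u)) (∑heavyPart≤ (heavy G u) refl) ⟩
    ℕtoℚ (y G C u) + (ℕtoℚ (10 ℕ.* y G C u) + ℕtoℚ 2 * clusterMean u) ∎
    where
    open ≤-Reasoning
    heavyPart : Fin n → ℚ
    heavyPart v = if heavy G u then [ sign u v ]· 1ℚ else [ similarNegative u v ]· r u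
    ∑heavyPart≤ : ∀ h → heavy G u ≡ h →
                  ∑[ v < n ] (if h then [ sign u v ]· 1ℚ else [ similarNegative u v ]· r u) ≤
                  ℕtoℚ (10 ℕ.* y G C u) + ℕtoℚ 2 * clusterMean u
    ∑heavyPart≤ true heavy-u = begin
      ∑[ v < n ] [ sign u v ]· 1ℚ            ≡⟨ trans (∑-[]· (sign u) 1ℚ) (*-identityʳ (ℕtoℚ (Δ G u))) ⟩
      ℕtoℚ (Δ G u)                           ≤⟨ heavy⇒Δ≤10y+2*clusterMean u (subst T (sym heavy-u) _) ⟩
      ℕtoℚ (10 ℕ.* y G C u) + ℕtoℚ 2 * clusterMean u ∎
    ∑heavyPart≤ false light-u = ≤-+-nonNegʳ (begin
      ∑[ v < n ] [ similarNegative u v ]· r u    ≡⟨ ∑-[]· (similarNegative u) (r u) ⟩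
      ℕtoℚ (count (similarNegative u)) * r u     ≤⟨ *-monoʳ-≤-nonNeg (r u) {{nonNegative (r-nonNeg u)}}
                                                      (ℕtoℚ-mono-≤ (light⇒similarNegative≤4Δ u (subst T light-u))) ⟩
      ℕtoℚ (4 ℕ.* Δ G u) * r u                   ≡⟨ cong (_* r u) (ℕtoℚ-* 4 (Δ G u)) ⟩
      ℕtoℚ 4 * ℕtoℚ (Δ G u) * r u                ≡⟨ *-assoc (ℕtoℚ 4) (ℕtoℚ (Δ G u)) (r u) ⟩
      ℕtoℚ 4 * (ℕtoℚ (Δ G u) * r u)              ≡⟨ cong (ℕtoℚ 4 *_) (Δ*r≡y u) ⟩
      ℕtoℚ 4 * ℕtoℚ (y G C u)                    ≡⟨ ℕtoℚ-* 4 (y G C u) ⟨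
      ℕtoℚ (4 ℕ.* y G C u)                       ≤⟨ ℕtoℚ-mono-≤ (ℕ.*-monoˡ-≤ (y G C u) {4} {10} (ℕ.m≤m+n 4 6)) ⟩
      ℕtoℚ (10 ℕ.* y G C u)                      ∎)
      (2*clusterMean-nonNeg u)

  costℚ : ℚ
  costℚ = ∑[ u < n ] ℕtoℚ (y G C u)

  cost1≡costℚ : ℕtoℚ (cost1 G C) ≡ costℚ
  cost1≡costℚ = trans (cong ℕtoℚ (foldr-tabulate ℕ._+_ (y G C) 0 id)) (ℕtoℚ-∑ (y G C))

  ∑clusterMean≡costℚ : ∑[ u < n ] clusterMean u ≡ costℚ
  ∑clusterMean≡costℚ = begin
    ∑[ u < n ] ∑[ w < n ] [ same u w ]· ρ w u           ≡⟨ ∑-comm (λ u w → [ same u w ]· ρ w u) ⟩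
    ∑[ w < n ] ∑[ u < n ] [ same u w ]· ρ w u           ≡⟨ sum-cong-≗ (λ w → sum-cong-≗ (termwise w)) ⟩
    ∑[ w < n ] ∑[ u < n ] [ same w u ]· ρ w w           ≡⟨ sum-cong-≗ (λ w → ∑-[]· (same w) (ρ w w)) ⟩
    ∑[ w < n ] (ℕtoℚ (clusterSize w) * ρ w w)           ≡⟨ sum-cong-≗ (λ w → trans (*-comm (ℕtoℚ (clusterSize w)) (ρ w w))
                                                                                   (ratio-*-den (y G C w) (clusterSize-pos w))) ⟩
    costℚ                                               ∎
    where
    open ≡-Reasoning
    ρ : Fin n → Fin n → ℚ
    ρ w u = ratio (y G C w) (clusterSize u)
    termwise : ∀ w u → [ same u w ]· ρ w u ≡ [ same w u ]· ρ w w
    termwise w u rewrite same-sym w u with same u w in same-uw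
    ... | true  = cong (ratio (y G C w)) (clusterSize-cong (toWitness (subst T (sym same-uw) _)))
    ... | false = refl

  ∑budget≡ : ∑[ u < n ] (ℕtoℚ (y G C u) + (ℕtoℚ (10 ℕ.* y G C u) + ℕtoℚ 2 * clusterMean u)) ≡
             costℚ + (ℕtoℚ 10 * costℚ + ℕtoℚ 2 * costℚ)
  ∑budget≡ = begin
    ∑[ u < n ] (ℕtoℚ (y G C u) + (ℕtoℚ (10 ℕ.* y G C u) + ℕtoℚ 2 * clusterMean u))
      ≡⟨ ∑-distrib-+ (λ u → ℕtoℚ (y G C u)) (λ u → ℕtoℚ (10 ℕ.* y G C u) + ℕtoℚ 2 * clusterMean u) ⟩
    costℚ + ∑[ u < n ] (ℕtoℚ (10 ℕ.* y G C u) + ℕtoℚ 2 * clusterMean u)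
      ≡⟨ cong (costℚ +_) (∑-distrib-+ (λ u → ℕtoℚ (10 ℕ.* y G C u)) (λ u → ℕtoℚ 2 * clusterMean u)) ⟩
    costℚ + (∑[ u < n ] ℕtoℚ (10 ℕ.* y G C u) + ∑[ u < n ] (ℕtoℚ 2 * clusterMean u))
      ≡⟨ cong (λ s → costℚ + (s + ∑[ u < n ] (ℕtoℚ 2 * clusterMean u))) (trans (sum-cong-≗ (λ u → ℕtoℚ-* 10 (y G C u)))
                                                                                (sym (*-distribˡ-sum (ℕtoℚ 10) (λ u → ℕtoℚ (y G C u))))) ⟩
    costℚ + (ℕtoℚ 10 * costℚ + ∑[ u < n ] (ℕtoℚ 2 * clusterMean u))
      ≡⟨ cong (λ s → costℚ + (ℕtoℚ 10 * costℚ + s)) (trans (sym (*-distribˡ-sum (ℕtoℚ 2) clusterMean))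
                                                          (cong (ℕtoℚ 2 *_) ∑clusterMean≡costℚ)) ⟩
    costℚ + (ℕtoℚ 10 * costℚ + ℕtoℚ 2 * costℚ)
      ∎
    where open ≡-Reasoning

  fracCost≡∑∑pairCost : fracCost G ≡ ∑[ u < n ] ∑[ v < n ] pairCost u v
  fracCost≡∑∑pairCost = begin
    fracCost G
      ≡⟨ cong₂ _+_ (sumℚ²≡∑∑ positivePart) (sumℚ²≡∑∑ negativePart) ⟩
    ∑[ u < n ] ∑[ v < n ] positivePart u v + ∑[ u < n ] ∑[ v < n ] negativePart u v
      ≡⟨ ∑∑-distrib-+ positivePart negativePart ⟨
    ∑[ u < n ] ∑[ v < n ] (positivePart u v + negativePart u v)
      ≡⟨ sum-cong-≗ (λ u → sum-cong-≗ (λ v → split (sign u v) (f G u v))) ⟩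
    ∑[ u < n ] ∑[ v < n ] pairCost u v
      ∎
    where
    open ≡-Reasoning
    positivePart negativePart : Fin n → Fin n → ℚ
    positivePart u v = if sign u v then f G u v else 0ℚ
    negativePart u v = if sign u v then 0ℚ else 1ℚ - f G u v
    split : ∀ s x → (if s then x else 0ℚ) + (if s then 0ℚ else 1ℚ - x) ≡ (if s then x else 1ℚ - x)
    split true  x = +-identityʳ x
    split false x = +-identityˡ (1ℚ - x)

  fracCost≤27*cost1 : fracCost G ≤ ℕtoℚ 27 * ℕtoℚ (cost1 G C)
  fracCost≤27*cost1 = begin
    fracCost G
      ≡⟨ fracCost≡∑∑pairCost ⟩
    ∑[ u < n ] ∑[ v < n ] pairCost u v
      ≤⟨ ∑-mono-≤ (λ u → ∑-mono-≤ (pairCost-≤ u)) ⟩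
    ∑[ u < n ] ∑[ v < n ] ([ disagree u v ]· 1ℚ + (charge u v + charge v u))
      ≡⟨ ∑∑-distrib-+ (λ u v → [ disagree u v ]· 1ℚ) (λ u v → charge u v + charge v u) ⟩
    ∑[ u < n ] ∑[ v < n ] [ disagree u v ]· 1ℚ + ∑[ u < n ] ∑[ v < n ] (charge u v + charge v u)
      ≡⟨ cong₂ _+_ (sum-cong-≗ (λ u → sym (ℕtoℚ-count (disagree u))))
                   (trans (∑∑-distrib-+ charge (λ u v → charge v u)) (cong (S +_) (∑-comm (λ u v → charge v u)))) ⟩
    costℚ + (S + S)
      ≤⟨ +-monoʳ-≤ costℚ (+-mono-≤ S≤B S≤B) ⟩
    costℚ + (B + B)
      ≡⟨ solve 1 (λ o → let b = o :+ (con (ℕtoℚ 10) :* o :+ con (ℕtoℚ 2) :* o) in o :+ (b :+ b) := con (ℕtoℚ 27) :* o)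
               refl costℚ ⟩
    ℕtoℚ 27 * costℚ
      ≡⟨ cong (ℕtoℚ 27 *_) cost1≡costℚ ⟨
    ℕtoℚ 27 * ℕtoℚ (cost1 G C)
      ∎
    where
    open ≤-Reasoning
    open +-*-Solver
    S B : ℚ
    S = ∑[ u < n ] ∑[ v < n ] charge u v
    B = costℚ + (ℕtoℚ 10 * costℚ + ℕtoℚ 2 * costℚ)
    S≤B : S ≤ B
    S≤B = subst (S ≤_) ∑budget≡ (∑-mono-≤ ∑charge≤)

lemma7 : Σ ℕ λ c → (G : SignedGraph) → (o : ℕ) → IsOPT1 G o → fracCost G ≤ ℕtoℚ c * ℕtoℚ o
lemma7 = 27 , λ G o ((C , cost1≡o) , _) →
  subst (λ c → fracCost G ≤ ℕtoℚ 27 * ℕtoℚ c) cost1≡o (Charging.fracCost≤27*cost1 G C)
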